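{- Let $G$ be a bipartite Eulerian graph, and suppose $G$ has a subgraph $K\cong K_{3,2}$ such that removing the edges of $K$ from $G$ does not disconnect $G$. Let $v$ be a vertex of $G$ lying in the part of size $3$ of $K$. Then $G$ admits a pair of avoiding Eulerian circuits starting and ending at $v$.
   Context: All graphs are finite, simple and connected. An Eulerian circuit is a closed trail traversing every edge exactly once. Let $G$ be Eulerian with $m$ edges and $u$ a vertex. Two Eulerian circuits $u,v_1,\ldots,v_{m-1},u$ and $u,w_1,\ldots,w_{m-1},u$ are avoiding if for every $1\le i\le m-1$, $v_i\neq w_i$ and $v_i$ is not adjacent to $w_i$. -}

module Defs where

open import Data.Nat using (ℕ; zero; suc)
open import Data.Fin using (Fin; zero; suc; inject₁; toℕ)
open import Data.Bool using (Bool)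
open import Data.Product using (Σ; ∃; ∃-syntax; _×_; _,_)
open import Data.Sum using (_⊎_)
open import Relation.Nullary using (¬_; Dec)
open import Relation.Binary.PropositionalEquality using (_≡_; _≢_)

record Graph (n : ℕ) : Set₁ where
  field
    Adj    : Fin n → Fin n → Set
    adj?   : ∀ x y → Dec (Adj x y)
    sym    : ∀ {x y} → Adj x y → Adj y x
    irrefl : ∀ {x} → ¬ Adj x x
open Graph public

data Reach {n : ℕ} (E : Fin n → Fin n → Set) : Fin n → Fin n → Set where
  here : ∀ {x} → Reach E x x
  step : ∀ {x y z} → E x y → Reach E y z → Reach E x z

ConnectedRel : {n : ℕ} → (Fin n → Fin n → Set) → Set
ConnectedRel {n} E = ∀ (x y : Fin n) → Reach E x y

Connected : {n : ℕ} → Graph n → Set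
Connected G = ConnectedRel (Adj G)

Bipartite : {n : ℕ} → Graph n → Set
Bipartite {n} G = Σ (Fin n → Bool) λ c → ∀ x y → Adj G x y → c x ≢ c y

SameEdge : {n : ℕ} → Fin n → Fin n → Fin n → Fin n → Set
SameEdge x y a b = (x ≡ a × y ≡ b) ⊎ (x ≡ b × y ≡ a)

EulerianCircuit : {n : ℕ} → Graph n → Fin n → (m : ℕ) → (Fin (suc m) → Fin n) → Set
EulerianCircuit {n} G u m w =
  (w zero ≡ u) × (w (Data.Fin.fromℕ m) ≡ u)
  × (∀ (i : Fin m) → Adj G (w (inject₁ i)) (w (suc i)))
  × (∀ (a b : Fin n) → Adj G a b →
       Σ (Fin m) λ i → SameEdge (w (inject₁ i)) (w (suc i)) a b
         × (∀ (j : Fin m) → SameEdge (w (inject₁ j)) (w (suc j)) a b → j ≡ i))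

Eulerian : {n : ℕ} → Graph n → Set
Eulerian {n} G = Connected G × Σ (Fin n) λ u → Σ ℕ λ m → Σ (Fin (suc m) → Fin n) λ w →
  EulerianCircuit G u m w

Avoiding : {n : ℕ} → Graph n → (m : ℕ) → (Fin (suc m) → Fin n) → (Fin (suc m) → Fin n) → Set
Avoiding G m v w = ∀ (i : Fin (suc m)) → toℕ i ≢ 0 → toℕ i ≢ m →
  (v i ≢ w i) × ¬ Adj G (v i) (w i)

IsK32 : {n : ℕ} → Graph n → (Fin 3 → Fin n) → (Fin 2 → Fin n) → Set
IsK32 G a b =
  (∀ i j → a i ≡ a j → i ≡ j) × (∀ i j → b i ≡ b j → i ≡ j)
  × (∀ i j → a i ≢ b j) × (∀ i j → Adj G (a i) (b j))

KEdge : {n : ℕ} → (Fin 3 → Fin n) → (Fin 2 → Fin n) → Fin n → Fin n → Set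
KEdge a b x y = ∃[ i ] ∃[ j ] SameEdge x y (a i) (b j)

AdjMinusK : {n : ℕ} → Graph n → (Fin 3 → Fin n) → (Fin 2 → Fin n) → Fin n → Fin n → Set
AdjMinusK G a b x y = Adj G x y × ¬ KEdge a b x y

module Submission where

-- Let C be the 4-cycle v x y z of K, with x and z in the part of size 2. Removing the edges of C from an
-- Eulerian circuit of G leaves closed walks covering G − C; as G − C is connected, they splice into one
-- Eulerian circuit Q of G − C based at x. The circuits v x Q y z v and v z y x Q v are avoiding: vertices
-- at equal positions of two walks from v have the same colour in the bipartition, so are not adjacent, and
-- at each interior position the two circuits show vertices two steps apart on the walk z y x Q y z, which
-- differ because Q is a trail that avoids the edges of C.

open import Defs hiding (sym)
open import Data.Nat using (ℕ; zero; suc; _+_; _≤_; _<_; z≤n; s≤s)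
open import Data.Nat.Properties hiding (_≟_)
import Data.Nat as ℕ
open import Algebra.Properties.CommutativeSemigroup +-commutativeSemigroup
  using (x∙yz≈y∙xz; x∙yz≈xz∙y)
open import Data.Fin using (Fin; zero; suc; inject₁; toℕ; fromℕ; _≟_)
import Data.Fin.Properties as Fin
open import Data.List using (List; []; _∷_; _++_; length)
open import Data.List.Properties using (length-++; ++-assoc)
open import Data.List.Membership.Propositional using (_∈_; find; lose)
open import Data.List.Membership.Propositional.Properties using (∈-++⁺ˡ; ∈-++⁺ʳ)
open import Data.List.Relation.Unary.Any using (Any; here; there; any?)
import Data.List.Relation.Unary.Any as Any
open import Data.Product using (Σ; ∃-syntax; _×_; _,_; proj₁; proj₂)
open import Data.Sum using (_⊎_; inj₁; inj₂; [_,_])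
open import Data.Unit using (⊤; tt)
open import Data.Bool using (Bool; not)
open import Data.Bool.Properties using (¬-not)
open import Data.List.Relation.Binary.Pointwise using (Pointwise; []; _∷_)
open import Function using (_∘_)
open import Relation.Nullary using (¬_; Dec; yes; no; contradiction)
open import Relation.Nullary.Decidable.Core using (_×-dec_; _⊎-dec_)
open import Relation.Binary.PropositionalEquality
  using (_≡_; _≢_; refl; sym; trans; cong; cong₂; subst; subst₂; module ≡-Reasoning)
open import Data.Nat.Solver using (module +-*-Solver)
open +-*-Solver using (solve; _:+_; _:=_; con)

indicator : {P : Set} → Dec P → ℕ
indicator (yes _) = 1
indicator (no _)  = 0

module _ {P : Set} where

  indicator-yes : (p? : Dec P) → P → indicator p? ≡ 1
  indicator-yes (yes _) _ = refl
  indicator-yes (no ¬p) p = contradiction p ¬p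

  indicator-no : (p? : Dec P) → ¬ P → indicator p? ≡ 0
  indicator-no (yes p) ¬p = contradiction p ¬p
  indicator-no (no _)  _  = refl

  indicator≤1 : (p? : Dec P) → indicator p? ≤ 1
  indicator≤1 (yes _) = ≤-refl
  indicator≤1 (no _)  = z≤n

indicator-mono : {P Q : Set} (p? : Dec P) (q? : Dec Q) → (P → Q) → indicator p? ≤ indicator q?
indicator-mono (yes p) q? P⇒Q = ≤-reflexive (sym (indicator-yes q? (P⇒Q p)))
indicator-mono (no _)  q? _   = z≤n

indicator-cong : {P Q : Set} (p? : Dec P) (q? : Dec Q) → (P → Q) → (Q → P) → indicator p? ≡ indicator q?
indicator-cong p? q? P⇒Q Q⇒P = ≤-antisym (indicator-mono p? q? P⇒Q) (indicator-mono q? p? Q⇒P)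

indicator-⊎ : {P Q : Set} (p? : Dec P) (q? : Dec Q) → ¬ (P × Q) →
              indicator p? + indicator q? ≡ indicator (p? ⊎-dec q?)
indicator-⊎ (yes p) (yes q) disjoint = contradiction (p , q) disjoint
indicator-⊎ (yes _) (no _)  _        = refl
indicator-⊎ (no _)  (yes _) _        = refl
indicator-⊎ (no _)  (no _)  _        = refl

disjoint-⊎ : {P Q R : Set} → ¬ (P × Q) → ¬ (P × R) → ¬ (P × (Q ⊎ R))
disjoint-⊎ ¬pq _   (p , inj₁ q) = ¬pq (p , q)
disjoint-⊎ _   ¬pr (p , inj₂ r) = ¬pr (p , r)

-- A walk is given by its first vertex and the list of the vertices that follow it.
module _ {n : ℕ} where

  sameEdge? : (x y a b : Fin n) → Dec (SameEdge x y a b)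
  sameEdge? x y a b = (x ≟ a ×-dec y ≟ b) ⊎-dec (x ≟ b ×-dec y ≟ a)

  δ : (x y a b : Fin n) → ℕ
  δ x y a b = indicator (sameEdge? x y a b)

  sameEdge-swap : ∀ {x y a b : Fin n} → SameEdge x y a b → SameEdge y x a b
  sameEdge-swap (inj₁ (x≡a , y≡b)) = inj₂ (y≡b , x≡a)
  sameEdge-swap (inj₂ (x≡b , y≡a)) = inj₁ (y≡a , x≡b)

  sameEdge-sym : ∀ {x y a b : Fin n} → SameEdge x y a b → SameEdge a b x y
  sameEdge-sym (inj₁ (refl , refl)) = inj₁ (refl , refl)
  sameEdge-sym (inj₂ (refl , refl)) = inj₂ (refl , refl)

  sameEdge-trans : ∀ {p q p′ q′ a b : Fin n} →
                   SameEdge p q a b → SameEdge p′ q′ a b → SameEdge p q p′ q′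
  sameEdge-trans (inj₁ (refl , refl)) (inj₁ (refl , refl)) = inj₁ (refl , refl)
  sameEdge-trans (inj₁ (refl , refl)) (inj₂ (refl , refl)) = inj₂ (refl , refl)
  sameEdge-trans (inj₂ (refl , refl)) (inj₁ (refl , refl)) = inj₂ (refl , refl)
  sameEdge-trans (inj₂ (refl , refl)) (inj₂ (refl , refl)) = inj₁ (refl , refl)

  Reach⇒firstStep : ∀ {E : Fin n → Fin n → Set} {p q} → p ≢ q → Reach E p q → ∃[ r ] E p r
  Reach⇒firstStep p≢q here       = contradiction refl p≢q
  Reach⇒firstStep _   (step e _) = _ , e

  δ-swap : ∀ x y a b → δ x y a b ≡ δ y x a b
  δ-swap x y a b = indicator-cong (sameEdge? x y a b) (sameEdge? y x a b) sameEdge-swap sameEdge-swap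

  δ-refl : ∀ x y → δ x y x y ≡ 1
  δ-refl x y = indicator-yes (sameEdge? x y x y) (inj₁ (refl , refl))

  end : Fin n → List (Fin n) → Fin n
  end s []       = s
  end s (p ∷ ps) = end p ps

  edgeCount : Fin n → List (Fin n) → Fin n → Fin n → ℕ
  edgeCount s []       a b = 0
  edgeCount s (p ∷ ps) a b = δ s p a b + edgeCount p ps a b

  reverseWalk : Fin n → List (Fin n) → List (Fin n)
  reverseWalk s []       = []
  reverseWalk s (p ∷ ps) = reverseWalk p ps ++ s ∷ []

  end-++ : ∀ s A B → end s (A ++ B) ≡ end (end s A) B
  end-++ s []      B = refl
  end-++ s (p ∷ A) B = end-++ p A B

  edgeCount-++ : ∀ s A B a b →
                 edgeCount s (A ++ B) a b ≡ edgeCount s A a b + edgeCount (end s A) B a b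
  edgeCount-++ s []      B a b = refl
  edgeCount-++ s (p ∷ A) B a b =
    trans (cong (δ s p a b +_) (edgeCount-++ p A B a b)) (sym (+-assoc (δ s p a b) _ _))

  end-reverseWalk : ∀ s ps → end (end s ps) (reverseWalk s ps) ≡ s
  end-reverseWalk s []       = refl
  end-reverseWalk s (p ∷ ps) = end-++ (end p ps) (reverseWalk p ps) (s ∷ [])

  edgeCount-reverseWalk : ∀ s ps a b → edgeCount (end s ps) (reverseWalk s ps) a b ≡ edgeCount s ps a b
  edgeCount-reverseWalk s []       a b = refl
  edgeCount-reverseWalk s (p ∷ ps) a b = begin
    edgeCount (end p ps) (reverseWalk p ps ++ s ∷ []) a b
      ≡⟨ edgeCount-++ (end p ps) (reverseWalk p ps) (s ∷ []) a b ⟩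
    edgeCount (end p ps) (reverseWalk p ps) a b
      + edgeCount (end (end p ps) (reverseWalk p ps)) (s ∷ []) a b
      ≡⟨ cong₂ _+_ (edgeCount-reverseWalk p ps a b)
                   (cong (λ t → edgeCount t (s ∷ []) a b) (end-reverseWalk p ps)) ⟩
    edgeCount p ps a b + (δ p s a b + 0)
      ≡⟨ cong (edgeCount p ps a b +_) (trans (+-identityʳ _) (δ-swap p s a b)) ⟩
    edgeCount p ps a b + δ s p a b
      ≡⟨ +-comm (edgeCount p ps a b) (δ s p a b) ⟩
    δ s p a b + edgeCount p ps a b ∎
    where open ≡-Reasoning

  end∈ : ∀ s A → end s A ∈ s ∷ A
  end∈ s []      = here refl
  end∈ s (p ∷ A) = there (end∈ p A)

  ∈-prefix : ∀ {z s : Fin n} {A} B → z ∈ s ∷ A → z ∈ s ∷ (A ++ B)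
  ∈-prefix B (here z≡s)  = here z≡s
  ∈-prefix B (there z∈A) = there (∈-++⁺ˡ z∈A)

  edgeCount≢0⇒traversed : ∀ s ps a b → edgeCount s ps a b ≢ 0 →
    ∃[ A ] ∃[ q ] ∃[ B ] ps ≡ A ++ q ∷ B × SameEdge (end s A) q a b
  edgeCount≢0⇒traversed s []       a b ≢0 = contradiction refl ≢0
  edgeCount≢0⇒traversed s (p ∷ ps) a b ≢0 with sameEdge? s p a b
  ... | yes e = [] , p , ps , refl , e
  ... | no _ with edgeCount≢0⇒traversed p ps a b ≢0
  ...   | A , q , B , refl , e = p ∷ A , q , B , refl , e

  edgeCount≢0⇒∈ : ∀ s ps a b → edgeCount s ps a b ≢ 0 → a ∈ s ∷ ps × b ∈ s ∷ ps
  edgeCount≢0⇒∈ s ps a b ≢0 with edgeCount≢0⇒traversed s ps a b ≢0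
  ... | A , q , B , refl , inj₁ (refl , refl) = ∈-prefix (q ∷ B) (end∈ s A) , there (∈-++⁺ʳ A (here refl))
  ... | A , q , B , refl , inj₂ (refl , refl) = there (∈-++⁺ʳ A (here refl)) , ∈-prefix (q ∷ B) (end∈ s A)

  ∈⇒split : ∀ {z} s ps → z ∈ s ∷ ps → ∃[ A ] ∃[ B ] ps ≡ A ++ B × end s A ≡ z
  ∈⇒split s ps       (here refl) = [] , ps , refl , refl
  ∈⇒split s (p ∷ ps) (there z∈ps) with ∈⇒split p ps z∈ps
  ... | A , B , refl , e = p ∷ A , B , refl , e

  toSteps : (k : ℕ) → (Fin (suc k) → Fin n) → List (Fin n)
  toSteps zero    f = []
  toSteps (suc k) f = f (suc zero) ∷ toSteps k (f ∘ suc)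

  end-toSteps : ∀ k f → end (f zero) (toSteps k f) ≡ f (fromℕ k)
  end-toSteps zero    f = refl
  end-toSteps (suc k) f = end-toSteps k (f ∘ suc)

  -- Positions past the end of a walk read as its last vertex.
  walkVertex : Fin n → List (Fin n) → ℕ → Fin n
  walkVertex s ps       zero    = s
  walkVertex s []       (suc t) = s
  walkVertex s (p ∷ ps) (suc t) = walkVertex p ps t

  toSteps-walkVertex : ∀ s ps → toSteps (length ps) (λ i → walkVertex s ps (toℕ i)) ≡ ps
  toSteps-walkVertex s []       = refl
  toSteps-walkVertex s (p ∷ ps) = cong (p ∷_) (toSteps-walkVertex p ps)

  walkVertex-++ : ∀ s A B t → t ≤ length A → walkVertex s (A ++ B) t ≡ walkVertex s A t
  walkVertex-++ s A       B zero    _         = refl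
  walkVertex-++ s (p ∷ A) B (suc t) (s≤s t≤A) = walkVertex-++ p A B t t≤A

  walkVertex-Pointwise≢ : ∀ {s s′ ps ps′} → Pointwise _≢_ (s ∷ ps) (s′ ∷ ps′) →
                          ∀ t → t ≤ length ps → walkVertex s ps t ≢ walkVertex s′ ps′ t
  walkVertex-Pointwise≢ (s≢s′ ∷ _)            zero    _          = s≢s′
  walkVertex-Pointwise≢ (_ ∷ ps≢ps′@(_ ∷ _)) (suc t) (s≤s t≤ps) = walkVertex-Pointwise≢ ps≢ps′ t t≤ps

  penultimate : Fin n → Fin n → List (Fin n) → Fin n
  penultimate s p []       = s
  penultimate s p (q ∷ ps) = penultimate p q ps

  edgeCount-lastEdge≢0 : ∀ s p ps → edgeCount s (p ∷ ps) (penultimate s p ps) (end p ps) ≢ 0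
  edgeCount-lastEdge≢0 s p [] count≡0 = contradiction (trans (sym (δ-refl s p)) (m+n≡0⇒m≡0 _ count≡0)) λ ()
  edgeCount-lastEdge≢0 s p (q ∷ ps) count≡0 =
    edgeCount-lastEdge≢0 p q ps (m+n≡0⇒n≡0 (δ s p (penultimate p q ps) (end q ps)) count≡0)

  -- A vertex reappearing two steps later would traverse an edge twice.
  trail⇒Pointwise≢ : ∀ {c d} a b L → (∀ u w → edgeCount a (b ∷ L) u w ≤ 1) →
                     c ≢ penultimate a b L → d ≢ end b L → Pointwise _≢_ (L ++ c ∷ d ∷ []) (a ∷ b ∷ L)
  trail⇒Pointwise≢ a b []      _     c≢ d≢ = c≢ ∷ d≢ ∷ []
  trail⇒Pointwise≢ a b (p ∷ L) trail c≢ d≢ =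
    p≢a ∷ trail⇒Pointwise≢ b p L (λ u w → m+n≤o⇒n≤o (δ a b u w) (trail u w)) c≢ d≢
    where
    p≢a : p ≢ a
    p≢a refl with trail p b
    ... | twice rewrite δ-refl p b | δ-swap b p p b | δ-refl p b with twice
    ...   | s≤s ()

  Traverses : ∀ {k} → (Fin (suc k) → Fin n) → Fin n → Fin n → Fin k → Set
  Traverses f a b i = SameEdge (f (inject₁ i)) (f (suc i)) a b

  traverses⇒edgeCount≢0 : ∀ k f a b i → Traverses f a b i → edgeCount (f zero) (toSteps k f) a b ≢ 0
  traverses⇒edgeCount≢0 (suc k) f a b zero    t count≡0 =
    contradiction (trans (sym (indicator-yes (sameEdge? (f zero) (f (suc zero)) a b) t))
                         (m+n≡0⇒m≡0 _ count≡0)) λ ()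
  traverses⇒edgeCount≢0 (suc k) f a b (suc i) t count≡0 =
    traverses⇒edgeCount≢0 k (f ∘ suc) a b i t (m+n≡0⇒n≡0 (δ (f zero) (f (suc zero)) a b) count≡0)

  edgeCount-toSteps≡0 : ∀ k f a b → (∀ i → ¬ Traverses f a b i) → edgeCount (f zero) (toSteps k f) a b ≡ 0
  edgeCount-toSteps≡0 zero    f a b _    = refl
  edgeCount-toSteps≡0 (suc k) f a b none =
    cong₂ _+_ (indicator-no (sameEdge? (f zero) (f (suc zero)) a b) (none zero))
              (edgeCount-toSteps≡0 k (f ∘ suc) a b (none ∘ suc))

  edgeCount-toSteps≡1 : ∀ k f a b i → Traverses f a b i → (∀ j → Traverses f a b j → j ≡ i) →
                        edgeCount (f zero) (toSteps k f) a b ≡ 1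
  edgeCount-toSteps≡1 (suc k) f a b zero    t unique =
    cong₂ _+_ (indicator-yes (sameEdge? (f zero) (f (suc zero)) a b) t)
              (edgeCount-toSteps≡0 k (f ∘ suc) a b λ j tj → contradiction (unique (suc j) tj) λ ())
  edgeCount-toSteps≡1 (suc k) f a b (suc i) t unique =
    cong₂ _+_ (indicator-no (sameEdge? (f zero) (f (suc zero)) a b) λ t₀ → contradiction (unique zero t₀) λ ())
              (edgeCount-toSteps≡1 k (f ∘ suc) a b i t λ j tj → Fin.suc-injective (unique (suc j) tj))

  edgeCount-toSteps≡1⇒unique : ∀ k f a b → edgeCount (f zero) (toSteps k f) a b ≡ 1 →
                               ∃[ i ] Traverses f a b i × (∀ j → Traverses f a b j → j ≡ i)
  edgeCount-toSteps≡1⇒unique (suc k) f a b count≡1 with sameEdge? (f zero) (f (suc zero)) a b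
  ... | yes t₀ = zero , t₀ , unique
    where
    unique : ∀ j → Traverses f a b j → j ≡ zero
    unique zero    _  = refl
    unique (suc j) tj = contradiction (suc-injective count≡1) (traverses⇒edgeCount≢0 k (f ∘ suc) a b j tj)
  ... | no ¬t₀ with edgeCount-toSteps≡1⇒unique k (f ∘ suc) a b count≡1
  ...   | i , t , unique = suc i , t , λ where
            zero    t₀ → contradiction t₀ ¬t₀
            (suc j) tj → cong suc (unique j tj)

module Walks {n : ℕ} (G : Graph n) where

  open import Data.List.Membership.DecPropositional (_≟_ {n}) using (_∈?_)

  adjacency : Fin n → Fin n → ℕ
  adjacency a b = indicator (adj? G a b)

  sameEdge-Adj : ∀ {x y a b} → Adj G x y → SameEdge x y a b → Adj G a b
  sameEdge-Adj xy (inj₁ (refl , refl)) = xy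
  sameEdge-Adj xy (inj₂ (refl , refl)) = Graph.sym G xy

  IsWalk : Fin n → List (Fin n) → Set
  IsWalk s []       = ⊤
  IsWalk s (p ∷ ps) = Adj G s p × IsWalk p ps

  isWalk-++ : ∀ s A B → IsWalk s A → IsWalk (end s A) B → IsWalk s (A ++ B)
  isWalk-++ s []      B _         wB = wB
  isWalk-++ s (p ∷ A) B (sp , wA) wB = sp , isWalk-++ p A B wA wB

  isWalk-++⁻ˡ : ∀ s A B → IsWalk s (A ++ B) → IsWalk s A
  isWalk-++⁻ˡ s []      B _        = tt
  isWalk-++⁻ˡ s (p ∷ A) B (sp , w) = sp , isWalk-++⁻ˡ p A B w

  isWalk-++⁻ʳ : ∀ s A B → IsWalk s (A ++ B) → IsWalk (end s A) B
  isWalk-++⁻ʳ s []      B w        = w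
  isWalk-++⁻ʳ s (p ∷ A) B (_ , w) = isWalk-++⁻ʳ p A B w

  isWalk-reverseWalk : ∀ s ps → IsWalk s ps → IsWalk (end s ps) (reverseWalk s ps)
  isWalk-reverseWalk s []       _        = tt
  isWalk-reverseWalk s (p ∷ ps) (sp , w) =
    isWalk-++ (end p ps) (reverseWalk p ps) (s ∷ []) (isWalk-reverseWalk p ps w)
      (subst (λ t → IsWalk t (s ∷ [])) (sym (end-reverseWalk p ps)) (Graph.sym G sp , tt))

  IsClosedWalk : Fin n → List (Fin n) → Set
  IsClosedWalk s ps = IsWalk s ps × end s ps ≡ s

  record ClosedWalk : Set where
    constructor closedWalk
    field
      start        : Fin n
      steps        : List (Fin n)
      isClosedWalk : IsClosedWalk start steps

  closedCount : ClosedWalk → Fin n → Fin n → ℕ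
  closedCount (closedWalk s ps _) = edgeCount s ps

  totalCount : List ClosedWalk → Fin n → Fin n → ℕ
  totalCount []       a b = 0
  totalCount (w ∷ ws) a b = closedCount w a b + totalCount ws a b

  vertices : ClosedWalk → List (Fin n)
  vertices (closedWalk s ps _) = s ∷ ps

  totalCount≢0⇒Any : ∀ ws a b → totalCount ws a b ≢ 0 → Any (λ w → closedCount w a b ≢ 0) ws
  totalCount≢0⇒Any []       a b ≢0 = contradiction refl ≢0
  totalCount≢0⇒Any (w ∷ ws) a b ≢0 with closedCount w a b ℕ.≟ 0
  ... | no  w≢0 = here w≢0
  ... | yes w≡0 = there (totalCount≢0⇒Any ws a b λ ws≡0 → ≢0 (cong₂ _+_ w≡0 ws≡0))

  select : ∀ {P : ClosedWalk → Set} ws → Any P ws →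
    Σ ClosedWalk λ w → Σ (List ClosedWalk) λ ws′ → P w × length ws ≡ suc (length ws′) ×
      (∀ a b → totalCount ws a b ≡ closedCount w a b + totalCount ws′ a b)
  select (w ∷ ws) (here pw) = w , ws , pw , refl , λ a b → refl
  select (u ∷ ws) (there p) with select ws p
  ... | w , ws′ , pw , len , count =
    w , u ∷ ws′ , pw , cong suc len ,
    λ a b → trans (cong (closedCount u a b +_) (count a b))
                  (x∙yz≈y∙xz (closedCount u a b) (closedCount w a b) (totalCount ws′ a b))

  rotate : ∀ c C D → IsClosedWalk c (C ++ D) →
    IsClosedWalk (end c C) (D ++ C) × (∀ a b → edgeCount (end c C) (D ++ C) a b ≡ edgeCount c (C ++ D) a b)
  rotate c C D (w , closed) =
    (isWalk-++ (end c C) D C (isWalk-++⁻ʳ c C D w) (subst (λ t → IsWalk t C) (sym D-ends) (isWalk-++⁻ˡ c C D w)) ,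
     trans (end-++ (end c C) D C) (cong (λ t → end t C) D-ends)) ,
    λ a b → begin
      edgeCount (end c C) (D ++ C) a b
        ≡⟨ edgeCount-++ (end c C) D C a b ⟩
      edgeCount (end c C) D a b + edgeCount (end (end c C) D) C a b
        ≡⟨ cong (λ t → edgeCount (end c C) D a b + edgeCount t C a b) D-ends ⟩
      edgeCount (end c C) D a b + edgeCount c C a b
        ≡⟨ +-comm (edgeCount (end c C) D a b) _ ⟩
      edgeCount c C a b + edgeCount (end c C) D a b
        ≡⟨ edgeCount-++ c C D a b ⟨
      edgeCount c (C ++ D) a b ∎
    where
    open ≡-Reasoning
    D-ends : end (end c C) D ≡ c
    D-ends = trans (sym (end-++ c C D)) closed

  rotateTo : ∀ {z} (w : ClosedWalk) → z ∈ vertices w →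
    Σ (List (Fin n)) λ ps → IsClosedWalk z ps × (∀ a b → edgeCount z ps a b ≡ closedCount w a b)
  rotateTo (closedWalk c cs closed) z∈w with ∈⇒split c cs z∈w
  ... | C , D , refl , refl = D ++ C , rotate c C D closed

  splice : ∀ s A B L → IsWalk s (A ++ B) → IsClosedWalk (end s A) L →
    IsWalk s (A ++ L ++ B) × end s (A ++ L ++ B) ≡ end s (A ++ B) ×
      (∀ a b → edgeCount s (A ++ L ++ B) a b ≡ edgeCount s (A ++ B) a b + edgeCount (end s A) L a b)
  splice s A B L w (wL , L-closed) =
    isWalk-++ s A (L ++ B) (isWalk-++⁻ˡ s A B w)
      (isWalk-++ (end s A) L B wL (subst (λ t → IsWalk t B) (sym L-closed) (isWalk-++⁻ʳ s A B w))) ,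
    trans (end-++ s A (L ++ B))
      (trans (end-++ (end s A) L B) (trans (cong (λ t → end t B) L-closed) (sym (end-++ s A B)))) ,
    count
    where
    count : ∀ a b → edgeCount s (A ++ L ++ B) a b ≡ edgeCount s (A ++ B) a b + edgeCount (end s A) L a b
    count a b
      rewrite edgeCount-++ s A (L ++ B) a b | edgeCount-++ (end s A) L B a b | L-closed | edgeCount-++ s A B a b =
      x∙yz≈xz∙y (edgeCount s A a b) (edgeCount (end s A) L a b) (edgeCount (end s A) B a b)

  closedCount≢0⇒∈ : ∀ w a b → closedCount w a b ≢ 0 → a ∈ vertices w × b ∈ vertices w
  closedCount≢0⇒∈ (closedWalk s ps _) = edgeCount≢0⇒∈ s ps

  splitAtEdge : ∀ s P w → IsWalk s P → edgeCount s P s w ≢ 0 →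
    ∃[ K ] ∃[ R ] IsClosedWalk s K × IsWalk w R × end w R ≡ end s P ×
      (∀ a b → edgeCount s P a b ≡ δ s w a b + edgeCount w R a b + edgeCount s K a b)
  splitAtEdge s P w wP ≢0 with edgeCount≢0⇒traversed s P s w ≢0
  ... | A , q , B , refl , inj₁ (A-closed , refl) =
    A , B , (isWalk-++⁻ˡ s A (w ∷ B) wP , A-closed) , proj₂ (isWalk-++⁻ʳ s A (w ∷ B) wP) ,
    sym (end-++ s A (w ∷ B)) , count
    where
    count : ∀ a b → edgeCount s (A ++ w ∷ B) a b ≡ δ s w a b + edgeCount w B a b + edgeCount s A a b
    count a b rewrite edgeCount-++ s A (w ∷ B) a b | A-closed = +-comm (edgeCount s A a b) _
  ... | A , q , B , refl , inj₂ (refl , refl) =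
    [] , reverseWalk s A ++ B , (tt , refl) ,
    isWalk-++ (end s A) (reverseWalk s A) B (isWalk-reverseWalk s A (isWalk-++⁻ˡ s A (s ∷ B) wP))
      (subst (λ t → IsWalk t B) (sym (end-reverseWalk s A)) (proj₂ (isWalk-++⁻ʳ s A (s ∷ B) wP))) ,
    trans (end-++ (end s A) (reverseWalk s A) B)
      (trans (cong (λ t → end t B) (end-reverseWalk s A)) (sym (end-++ s A (s ∷ B)))) ,
    count
    where
    count : ∀ a b → edgeCount s (A ++ s ∷ B) a b
                    ≡ δ s (end s A) a b + edgeCount (end s A) (reverseWalk s A ++ B) a b + 0
    count a b
      rewrite edgeCount-++ s A (s ∷ B) a b | edgeCount-++ (end s A) (reverseWalk s A) B a b
            | end-reverseWalk s A | edgeCount-reverseWalk s A a b | δ-swap s (end s A) a b =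
      solve 3 (λ x d y → x :+ (d :+ y) := d :+ (x :+ y) :+ con 0) refl
        (edgeCount s A a b) (δ (end s A) s a b) (edgeCount s B a b)

  absorbEdge : ∀ s P ws w → IsWalk s P → edgeCount s P s w + totalCount ws s w ≢ 0 →
    ∃[ P′ ] ∃[ ws′ ] IsWalk s P′ × end s P′ ≡ end s P × edgeCount s P′ s w ≢ 0 ×
      (∀ a b → edgeCount s P a b + totalCount ws a b ≡ edgeCount s P′ a b + totalCount ws′ a b)
  absorbEdge s P ws w wP ≢0 with edgeCount s P s w ℕ.≟ 0
  ... | no P≢0 = P , ws , wP , refl , P≢0 , λ a b → refl
  ... | yes P≡0 with select ws (totalCount≢0⇒Any ws s w λ ws≡0 → ≢0 (cong₂ _+_ P≡0 ws≡0))
  ...   | W , ws′ , W≢0 , _ , count with rotateTo W (proj₁ (closedCount≢0⇒∈ W s w W≢0))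
  ...     | K , K-closed , K-count with splice s [] P K wP K-closed
  ...       | wKP , KP-end , KP-count = K ++ P , ws′ , wKP , KP-end , KP≢0 , λ a b → begin
    edgeCount s P a b + totalCount ws a b
      ≡⟨ cong (edgeCount s P a b +_) (count a b) ⟩
    edgeCount s P a b + (closedCount W a b + totalCount ws′ a b)
      ≡⟨ +-assoc (edgeCount s P a b) (closedCount W a b) (totalCount ws′ a b) ⟨
    edgeCount s P a b + closedCount W a b + totalCount ws′ a b
      ≡⟨ cong (λ t → edgeCount s P a b + t + totalCount ws′ a b) (K-count a b) ⟨
    edgeCount s P a b + edgeCount s K a b + totalCount ws′ a b
      ≡⟨ cong (_+ totalCount ws′ a b) (KP-count a b) ⟨
    edgeCount s (K ++ P) a b + totalCount ws′ a b ∎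
    where
    open ≡-Reasoning
    KP≢0 : edgeCount s (K ++ P) s w ≢ 0
    KP≢0 KP≡0 = W≢0 (trans (sym (K-count s w))
                      (m+n≡0⇒n≡0 (edgeCount s P s w) (trans (sym (KP-count s w)) KP≡0)))

  peelEdge : ∀ s P ws w → IsWalk s P → edgeCount s P s w + totalCount ws s w ≢ 0 →
    ∃[ R ] ∃[ ws′ ] IsWalk w R × end w R ≡ end s P ×
      (∀ a b → edgeCount s P a b + totalCount ws a b ≡ δ s w a b + (edgeCount w R a b + totalCount ws′ a b))
  peelEdge s P ws w wP ≢0 with absorbEdge s P ws w wP ≢0
  ... | P′ , ws′ , wP′ , P′-end , P′≢0 , count with splitAtEdge s P′ w wP′ P′≢0
  ...   | K , R , K-closed , wR , R-end , split =
    R , closedWalk s K K-closed ∷ ws′ , wR , trans R-end P′-end ,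
    λ a b → trans (count a b) (trans (cong (_+ totalCount ws′ a b) (split a b))
      (solve 4 (λ d r k t → d :+ r :+ k :+ t := d :+ (r :+ (k :+ t))) refl
        (δ s w a b) (edgeCount w R a b) (edgeCount s K a b) (totalCount ws′ a b)))

  -- The steps of πs are peeled off P one at a time; when the next edge is not on P, the closed walk of ws
  -- carrying it is first spliced into P.
  decomposeDifference : ∀ πs s P ws → IsWalk s P → end s P ≡ end s πs →
    (∀ a b → edgeCount s πs a b ≤ edgeCount s P a b + totalCount ws a b) →
    ∃[ ws′ ] ∀ a b → totalCount ws′ a b + edgeCount s πs a b ≡ edgeCount s P a b + totalCount ws a b
  decomposeDifference [] s P ws wP P-end _ =
    closedWalk s P (wP , P-end) ∷ ws , λ a b → +-identityʳ _
  decomposeDifference (w ∷ πs) s P ws wP P-end bound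
    with peelEdge s P ws w wP edge≢0
    where
    edge≢0 : edgeCount s P s w + totalCount ws s w ≢ 0
    edge≢0 e with subst (1 ≤_) e (≤-trans (≤-trans (≤-reflexive (sym (δ-refl s w))) (m≤m+n _ _)) (bound s w))
    ... | ()
  ... | R , ws″ , wR , R-end , peel
    with decomposeDifference πs w R ws″ wR (trans R-end P-end)
           (λ a b → +-cancelˡ-≤ (δ s w a b) _ _ (≤-trans (bound a b) (≤-reflexive (peel a b))))
  ... | ws′ , rest = ws′ , λ a b →
    trans (x∙yz≈y∙xz (totalCount ws′ a b) (δ s w a b) (edgeCount w πs a b))
      (trans (cong (δ s w a b +_) (rest a b)) (sym (peel a b)))

  module Merge (x : Fin n) (E : Fin n → Fin n → Set) (reach : ∀ q → Reach E x q) where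

    Covers : List (Fin n) → List ClosedWalk → Set
    Covers ts ws = ∀ a b → E a b → edgeCount x ts a b + totalCount ws a b ≢ 0

    Meets : List (Fin n) → ClosedWalk → Set
    Meets ts w = Any (_∈ x ∷ ts) (vertices w)

    reach⇒meets : ∀ ts ws {p q} → Covers ts ws → Reach E p q → p ∈ x ∷ ts →
                  Any (λ w → q ∈ vertices w) ws → Any (Meets ts) ws
    reach⇒meets ts ws cov here p∈ts q∈ws = Any.map (λ q∈w → lose q∈w p∈ts) q∈ws
    reach⇒meets ts ws {p} cov (step {y = p′} e r) p∈ts q∈ws with totalCount ws p p′ ℕ.≟ 0
    ... | no ws≢0 =
      Any.map (λ {w} w≢0 → lose (proj₁ (closedCount≢0⇒∈ w p p′ w≢0)) p∈ts)
              (totalCount≢0⇒Any ws p p′ ws≢0)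
    ... | yes ws≡0 = reach⇒meets ts ws cov r (proj₂ (edgeCount≢0⇒∈ x ts p p′ ts≢0)) q∈ws
      where
      ts≢0 : edgeCount x ts p p′ ≢ 0
      ts≢0 ts≡0 = cov p p′ e (cong₂ _+_ ts≡0 ws≡0)

    ¬meets⇒totalCount≡0 : ∀ ts ws → Covers ts ws → ¬ Any (Meets ts) ws → ∀ a b → totalCount ws a b ≡ 0
    ¬meets⇒totalCount≡0 ts ws cov ¬meets a b with totalCount ws a b ℕ.≟ 0
    ... | yes ws≡0 = ws≡0
    ... | no ws≢0 = contradiction (reach⇒meets ts ws cov (reach a) (here refl)
                      (Any.map (λ {w} w≢0 → proj₁ (closedCount≢0⇒∈ w a b w≢0))
                               (totalCount≢0⇒Any ws a b ws≢0)))
                      ¬meets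

    merge : ∀ k ws → length ws ≤ k → ∀ ts → IsClosedWalk x ts → Covers ts ws →
      ∃[ ts′ ] IsClosedWalk x ts′ × (∀ a b → edgeCount x ts′ a b ≡ edgeCount x ts a b + totalCount ws a b)
    merge zero    []      _   ts closed _   = ts , closed , λ a b → sym (+-identityʳ _)
    merge (suc k) ws      len ts closed cov with any? (λ w → any? (_∈? x ∷ ts) (vertices w)) ws
    ... | no ¬meets =
      ts , closed , λ a b → sym (trans (cong (edgeCount x ts a b +_) (¬meets⇒totalCount≡0 ts ws cov ¬meets a b))
                                       (+-identityʳ _))
    ... | yes meets with select ws meets
    ... | W , ws′ , W-meets , len-eq , count with find W-meets
    ... | z , z∈W , z∈ts with ∈⇒split x ts z∈ts
    ... | A , B , refl , refl with rotateTo W z∈W | closed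
    ... | L , L-closed , L-count | wAB , AB-end with splice x A B L wAB L-closed
    ... | wALB , ALB-end , ALB-count =
      let ts′ , closed′ , merged = merge k ws′ (≤-pred (subst (_≤ suc k) len-eq len)) (A ++ L ++ B)
                                     (wALB , trans ALB-end AB-end)
                                     (λ a b e ≡0 → cov a b e (trans (sym (spliced a b)) ≡0))
      in ts′ , closed′ , λ a b → trans (merged a b) (spliced a b)
      where
      spliced : ∀ a b → edgeCount x (A ++ L ++ B) a b + totalCount ws′ a b
                        ≡ edgeCount x (A ++ B) a b + totalCount ws a b
      spliced a b = begin
        edgeCount x (A ++ L ++ B) a b + totalCount ws′ a b
          ≡⟨ cong (_+ totalCount ws′ a b)
                  (trans (ALB-count a b) (cong (edgeCount x (A ++ B) a b +_) (L-count a b))) ⟩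
        edgeCount x (A ++ B) a b + closedCount W a b + totalCount ws′ a b
          ≡⟨ +-assoc (edgeCount x (A ++ B) a b) (closedCount W a b) (totalCount ws′ a b) ⟩
        edgeCount x (A ++ B) a b + (closedCount W a b + totalCount ws′ a b)
          ≡⟨ cong (edgeCount x (A ++ B) a b +_) (count a b) ⟨
        edgeCount x (A ++ B) a b + totalCount ws a b ∎
        where open ≡-Reasoning

  isWalk-toSteps : ∀ k f → (∀ i → Adj G (f (inject₁ i)) (f (suc i))) → IsWalk (f zero) (toSteps k f)
  isWalk-toSteps zero    f _     = tt
  isWalk-toSteps (suc k) f steps = steps zero , isWalk-toSteps k (f ∘ suc) (steps ∘ suc)

  isWalk-toSteps⁻ : ∀ k f → IsWalk (f zero) (toSteps k f) → ∀ i → Adj G (f (inject₁ i)) (f (suc i))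
  isWalk-toSteps⁻ (suc k) f (step₀ , _) zero    = step₀
  isWalk-toSteps⁻ (suc k) f (_ , w)     (suc i) = isWalk-toSteps⁻ k (f ∘ suc) w i

  eulerianCircuit⇒closedWalk : ∀ {u k f} → EulerianCircuit G u k f →
    IsClosedWalk (f zero) (toSteps k f) × (∀ a b → edgeCount (f zero) (toSteps k f) a b ≡ adjacency a b)
  eulerianCircuit⇒closedWalk {u} {k} {f} (first≡u , last≡u , steps , once) =
    (isWalk-toSteps k f steps , trans (end-toSteps k f) (trans last≡u (sym first≡u))) , count
    where
    count : ∀ a b → edgeCount (f zero) (toSteps k f) a b ≡ adjacency a b
    count a b with adj? G a b
    ... | yes ab = let i , t , unique = once a b ab in edgeCount-toSteps≡1 k f a b i t unique
    ... | no ¬ab = edgeCount-toSteps≡0 k f a b λ i t → ¬ab (sameEdge-Adj (steps i) t)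

  closedWalk⇒eulerianCircuit : ∀ s ps m → length ps ≡ m → IsClosedWalk s ps →
    (∀ a b → edgeCount s ps a b ≡ adjacency a b) → EulerianCircuit G s m (λ i → walkVertex s ps (toℕ i))
  closedWalk⇒eulerianCircuit s ps _ refl (w , closed) count =
    refl ,
    trans (sym (end-toSteps (length ps) f)) (trans (cong (end s) steps≡ps) closed) ,
    isWalk-toSteps⁻ (length ps) f (subst (IsWalk s) (sym steps≡ps) w) ,
    λ a b ab → edgeCount-toSteps≡1⇒unique (length ps) f a b
                 (trans (cong (λ qs → edgeCount s qs a b) steps≡ps)
                   (trans (count a b) (indicator-yes (adj? G a b) ab)))
    where
    f : Fin (suc (length ps)) → Fin n
    f i = walkVertex s ps (toℕ i)
    steps≡ps : toSteps (length ps) f ≡ ps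
    steps≡ps = toSteps-walkVertex s ps

  module _ (col : Fin n → Bool) (proper : ∀ a b → Adj G a b → col a ≢ col b) where

    colour-walkVertex : ∀ {s s′} ps ps′ → col s ≡ col s′ → IsWalk s ps → IsWalk s′ ps′ →
      ∀ t → t ≤ length ps → t ≤ length ps′ → col (walkVertex s ps t) ≡ col (walkVertex s′ ps′ t)
    colour-walkVertex ps ps′ same _ _ zero _ _ = same
    colour-walkVertex {s} {s′} (p ∷ ps) (p′ ∷ ps′) same (sp , w) (s′p′ , w′)
                      (suc t) (s≤s t≤) (s≤s t≤′) =
      colour-walkVertex ps ps′ next w w′ t t≤ t≤′
      where
      next : col p ≡ col p′
      next = trans (¬-not (proper p s (Graph.sym G sp)))
               (trans (cong not same) (sym (¬-not (proper p′ s′ (Graph.sym G s′p′)))))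

  adj⇒≢ : ∀ {p q} → Adj G p q → p ≢ q
  adj⇒≢ pq refl = irrefl G pq

  complementCircuit : ∀ s ps x C (E : Fin n → Fin n → Set) →
    IsClosedWalk s ps → (∀ a b → edgeCount s ps a b ≡ adjacency a b) →
    end x C ≡ x → (∀ a b → edgeCount x C a b ≤ adjacency a b) →
    (∀ a b → E a b → Adj G a b × edgeCount x C a b ≡ 0) → (∀ q → Reach E x q) →
    ∃[ Q ] IsClosedWalk x Q × (∀ a b → edgeCount x Q a b + edgeCount x C a b ≡ adjacency a b)
  complementCircuit s ps x C E closed euler C-end C≤adj outside reach =
    let ws , split = decomposeDifference C x [] (closedWalk s ps closed ∷ []) tt (sym C-end)
                       λ a b → subst (edgeCount x C a b ≤_) (sym (trans (+-identityʳ _) (euler a b))) (C≤adj a b)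
        remainder : ∀ a b → totalCount ws a b + edgeCount x C a b ≡ adjacency a b
        remainder a b = trans (split a b) (trans (+-identityʳ _) (euler a b))
        Q , Q-closed , merged = merge (length ws) ws ≤-refl [] (tt , refl) λ a b e ws≡0 →
          let ab , C≡0 = outside a b e in
          contradiction (trans (sym (indicator-yes (adj? G a b) ab))
                          (trans (sym (remainder a b)) (cong₂ _+_ ws≡0 C≡0))) λ ()
    in Q , Q-closed , λ a b → trans (cong (_+ edgeCount x C a b) (merged a b)) (remainder a b)
    where open Merge x E reach

AvoidingPair : {n : ℕ} → Graph n → Fin n → Set
AvoidingPair {n} G u = Σ ℕ λ m → Σ (Fin (suc m) → Fin n) λ w₁ → Σ (Fin (suc m) → Fin n) λ w₂ →
  EulerianCircuit G u m w₁ × EulerianCircuit G u m w₂ × Avoiding G m w₁ w₂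

module Reroute {n : ℕ} (G : Graph n) (col : Fin n → Bool) (proper : ∀ a b → Adj G a b → col a ≢ col b)
  (v x y z : Fin n) (vx : Adj G v x) (xy : Adj G x y) (yz : Adj G y z) (zv : Adj G z v)
  (x≢z : x ≢ z) (y≢v : y ≢ v)
  (E : Fin n → Fin n → Set)
  (outside : ∀ a b → E a b → Adj G a b × edgeCount x (y ∷ z ∷ v ∷ x ∷ []) a b ≡ 0)
  (reach : ∀ q → Reach E x q) where

  open Walks G

  cycle : List (Fin n)
  cycle = y ∷ z ∷ v ∷ x ∷ []

  cycleCount≤adjacency : ∀ a b → edgeCount x cycle a b ≤ adjacency a b
  cycleCount≤adjacency a b = begin
    δ x y a b + (δ y z a b + (δ z v a b + (δ v x a b + 0)))
      ≡⟨ cong (λ t → δ x y a b + (δ y z a b + (δ z v a b + t))) (+-identityʳ _) ⟩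
    δ x y a b + (δ y z a b + (δ z v a b + δ v x a b))
      ≡⟨ cong (λ t → δ x y a b + (δ y z a b + t)) (indicator-⊎ (e? z v) (e? v x) zv∥vx) ⟩
    δ x y a b + (δ y z a b + indicator (e? z v ⊎-dec e? v x))
      ≡⟨ cong (δ x y a b +_) (indicator-⊎ (e? y z) _ (disjoint-⊎ yz∥zv yz∥vx)) ⟩
    δ x y a b + indicator (e? y z ⊎-dec e? z v ⊎-dec e? v x)
      ≡⟨ indicator-⊎ (e? x y) _ (disjoint-⊎ xy∥yz (disjoint-⊎ xy∥zv xy∥vx)) ⟩
    indicator (e? x y ⊎-dec e? y z ⊎-dec e? z v ⊎-dec e? v x)
      ≤⟨ indicator-mono _ (adj? G a b)
           [ sameEdge-Adj xy , [ sameEdge-Adj yz , [ sameEdge-Adj zv , sameEdge-Adj vx ] ] ] ⟩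
    adjacency a b ∎
    where
    open ≤-Reasoning
    e? : ∀ p q → Dec (SameEdge p q a b)
    e? p q = sameEdge? p q a b
    apart : ∀ {p q p′ q′} → p ≢ p′ → p ≢ q′ → ¬ (SameEdge p q a b × SameEdge p′ q′ a b)
    apart p≢p′ p≢q′ (e , e′) with sameEdge-trans e e′
    ... | inj₁ (p≡p′ , _) = p≢p′ p≡p′
    ... | inj₂ (p≡q′ , _) = p≢q′ p≡q′
    xy∥yz : ¬ (SameEdge x y a b × SameEdge y z a b)
    xy∥yz = apart (adj⇒≢ xy) x≢z
    xy∥zv : ¬ (SameEdge x y a b × SameEdge z v a b)
    xy∥zv = apart x≢z (adj⇒≢ (Graph.sym G vx))
    xy∥vx : ¬ (SameEdge x y a b × SameEdge v x a b)
    xy∥vx (e , e′) = apart y≢v (adj⇒≢ (Graph.sym G xy)) (sameEdge-swap e , e′)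
    yz∥zv : ¬ (SameEdge y z a b × SameEdge z v a b)
    yz∥zv = apart (adj⇒≢ yz) y≢v
    yz∥vx : ¬ (SameEdge y z a b × SameEdge v x a b)
    yz∥vx = apart y≢v (adj⇒≢ (Graph.sym G xy))
    zv∥vx : ¬ (SameEdge z v a b × SameEdge v x a b)
    zv∥vx = apart (adj⇒≢ zv) (x≢z ∘ sym)

  -- If Q were empty, the first step of a path in G − C from x to v would be missing from it;
  -- otherwise the last edge of Q would be the edge x y of the cycle.
  y≢penultimate : ∀ Q → end x Q ≡ x → (∀ a b → edgeCount x Q a b + edgeCount x cycle a b ≡ adjacency a b) →
                  y ≢ penultimate y x Q
  y≢penultimate [] _ count _ =
    let p , e = Reach⇒firstStep (adj⇒≢ (Graph.sym G vx)) (reach v)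
        xp , C≡0 = outside x p e
    in contradiction (trans (sym C≡0) (trans (count x p) (indicator-yes (adj? G x p) xp))) λ ()
  y≢penultimate (r ∷ R) Q-end count y≡ =
    contradiction (≤-trans (+-mono-≤ (n≢0⇒n>0 Q-yx≢0) C-yx)
                           (≤-trans (≤-reflexive (count y x)) (indicator≤1 _)))
                  λ { (s≤s ()) }
    where
    Q-yx≢0 : edgeCount x (r ∷ R) y x ≢ 0
    Q-yx≢0 = subst₂ (λ p q → edgeCount x (r ∷ R) p q ≢ 0) (sym y≡) Q-end (edgeCount-lastEdge≢0 x r R)
    C-yx : 1 ≤ edgeCount x cycle y x
    C-yx = ≤-trans (≤-reflexive (sym (trans (δ-swap x y y x) (δ-refl y x)))) (m≤m+n _ _)

  module _ (Q : List (Fin n)) (Q-closed : IsClosedWalk x Q)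
           (Q-count : ∀ a b → edgeCount x Q a b + edgeCount x cycle a b ≡ adjacency a b) where

    circuit₁ circuit₂ : List (Fin n)
    circuit₁ = x ∷ Q ++ y ∷ z ∷ v ∷ []
    circuit₂ = z ∷ y ∷ x ∷ Q ++ v ∷ []

    m : ℕ
    m = 4 + length Q

    Q-end : end x Q ≡ x
    Q-end = proj₂ Q-closed

    closed₁ : IsClosedWalk v circuit₁
    closed₁ = (vx , isWalk-++ x Q (y ∷ z ∷ v ∷ []) (proj₁ Q-closed)
                      (subst (λ t → IsWalk t (y ∷ z ∷ v ∷ [])) (sym Q-end) (xy , yz , zv , tt))) ,
              end-++ x Q (y ∷ z ∷ v ∷ [])

    closed₂ : IsClosedWalk v circuit₂
    closed₂ = (Graph.sym G zv , Graph.sym G yz , Graph.sym G xy ,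
               isWalk-++ x Q (v ∷ []) (proj₁ Q-closed)
                 (subst (λ t → IsWalk t (v ∷ [])) (sym Q-end) (Graph.sym G vx , tt))) ,
              end-++ x Q (v ∷ [])

    count₁ : ∀ a b → edgeCount v circuit₁ a b ≡ adjacency a b
    count₁ a b rewrite edgeCount-++ x Q (y ∷ z ∷ v ∷ []) a b | Q-end | sym (Q-count a b) =
      solve 5 (λ q xy yz zv vx → vx :+ (q :+ (xy :+ (yz :+ (zv :+ con 0))))
                                := q :+ (xy :+ (yz :+ (zv :+ (vx :+ con 0))))) refl
        (edgeCount x Q a b) (δ x y a b) (δ y z a b) (δ z v a b) (δ v x a b)

    count₂ : ∀ a b → edgeCount v circuit₂ a b ≡ adjacency a b
    count₂ a b
      rewrite edgeCount-++ x Q (v ∷ []) a b | Q-end | sym (Q-count a b)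
            | δ-swap v z a b | δ-swap z y a b | δ-swap y x a b | δ-swap x v a b =
      solve 5 (λ q xy yz zv vx → zv :+ (yz :+ (xy :+ (q :+ (vx :+ con 0))))
                                := q :+ (xy :+ (yz :+ (zv :+ (vx :+ con 0))))) refl
        (edgeCount x Q a b) (δ x y a b) (δ y z a b) (δ z v a b) (δ v x a b)

    length₁ : length circuit₁ ≡ m
    length₁ = cong suc (trans (length-++ Q) (+-comm (length Q) 3))

    length₂ : length circuit₂ ≡ m
    length₂ = cong (3 +_) (trans (length-++ Q) (+-comm (length Q) 1))

    trail : ∀ a b → edgeCount z (y ∷ x ∷ Q) a b ≤ 1
    trail a b = begin
      edgeCount z (y ∷ x ∷ Q) a b
        ≤⟨ m≤m+n _ _ ⟩
      edgeCount z (y ∷ x ∷ Q) a b + edgeCount (end z (y ∷ x ∷ Q)) (v ∷ []) a b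
        ≡⟨ edgeCount-++ z (y ∷ x ∷ Q) (v ∷ []) a b ⟨
      edgeCount z (y ∷ x ∷ Q ++ v ∷ []) a b
        ≤⟨ m≤n+m _ (δ v z a b) ⟩
      edgeCount v circuit₂ a b
        ≡⟨ count₂ a b ⟩
      adjacency a b
        ≤⟨ indicator≤1 (adj? G a b) ⟩
      1 ∎
      where open ≤-Reasoning

    shifted : Pointwise _≢_ (x ∷ Q ++ y ∷ z ∷ []) (z ∷ y ∷ x ∷ Q)
    shifted = trail⇒Pointwise≢ z y (x ∷ Q) trail (y≢penultimate Q Q-end Q-count)
                λ z≡ → x≢z (sym (trans z≡ Q-end))

    distinct : ∀ t → t ≢ 0 → t < m → walkVertex v circuit₁ t ≢ walkVertex v circuit₂ t
    distinct zero    t≢0 _         = contradiction refl t≢0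
    distinct (suc t) _   (s≤s t<m) eq =
      walkVertex-Pointwise≢ shifted t t≤ (trans (sym drop₁) (trans eq drop₂))
      where
      t≤ : t ≤ length (Q ++ y ∷ z ∷ [])
      t≤ = subst (t ≤_) (sym (trans (length-++ Q) (+-comm (length Q) 2))) (≤-pred t<m)
      drop₁ : walkVertex x (Q ++ y ∷ z ∷ v ∷ []) t ≡ walkVertex x (Q ++ y ∷ z ∷ []) t
      drop₁ = trans (cong (λ qs → walkVertex x qs t) (sym (++-assoc Q (y ∷ z ∷ []) (v ∷ []))))
                    (walkVertex-++ x (Q ++ y ∷ z ∷ []) (v ∷ []) t t≤)
      drop₂ : walkVertex z (y ∷ x ∷ Q ++ v ∷ []) t ≡ walkVertex z (y ∷ x ∷ Q) t
      drop₂ = walkVertex-++ z (y ∷ x ∷ Q) (v ∷ []) t (≤-pred t<m)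

    w₁ w₂ : Fin (suc m) → Fin n
    w₁ i = walkVertex v circuit₁ (toℕ i)
    w₂ i = walkVertex v circuit₂ (toℕ i)

    avoiding : Avoiding G m w₁ w₂
    avoiding i i≢0 i≢m = distinct (toℕ i) i≢0 (≤∧≢⇒< i≤m i≢m) , λ adj → proper _ _ adj sameColour
      where
      i≤m : toℕ i ≤ m
      i≤m = ≤-pred (Fin.toℕ<n i)
      sameColour : col (w₁ i) ≡ col (w₂ i)
      sameColour = colour-walkVertex col proper circuit₁ circuit₂ refl (proj₁ closed₁) (proj₁ closed₂) (toℕ i)
                     (subst (toℕ i ≤_) (sym length₁) i≤m) (subst (toℕ i ≤_) (sym length₂) i≤m)

    reroutedPair : AvoidingPair G v
    reroutedPair =
      m , w₁ , w₂ ,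
      closedWalk⇒eulerianCircuit v circuit₁ m length₁ closed₁ count₁ ,
      closedWalk⇒eulerianCircuit v circuit₂ m length₂ closed₂ count₂ ,
      avoiding

  avoidingPair : Eulerian G → AvoidingPair G v
  avoidingPair (_ , u , k , f , circuit) =
    let closed , euler = eulerianCircuit⇒closedWalk circuit
        Q , Q-closed , Q-count = complementCircuit (f zero) (toSteps k f) x cycle E closed euler refl
                                   cycleCount≤adjacency outside reach
    in reroutedPair Q Q-closed Q-count

anotherIndex : ∀ {k} (i : Fin (suc (suc k))) → ∃[ j ] j ≢ i
anotherIndex zero    = suc zero , λ ()
anotherIndex (suc _) = zero , λ ()

lemma3 : (n : ℕ) (G : Graph n) → Bipartite G → Eulerian G →
    (a : Fin 3 → Fin n) (b : Fin 2 → Fin n) → IsK32 G a b →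
    ConnectedRel (AdjMinusK G a b) →
    (k : Fin 3) →
    Σ ℕ λ m → Σ (Fin (suc m) → Fin n) λ v → Σ (Fin (suc m) → Fin n) λ w →
      EulerianCircuit G (a k) m v × EulerianCircuit G (a k) m w × Avoiding G m v w
lemma3 n G (col , proper) eulerian a b (a-inj , b-inj , _ , ab) connected k =
  Reroute.avoidingPair G col proper (a k) (b b₀) (a j) (b b₁)
    (ab k b₀) (Graph.sym G (ab j b₀)) (ab j b₁) (Graph.sym G (ab k b₁))
    (λ b₀≡b₁ → contradiction (b-inj b₀ b₁ b₀≡b₁) λ ()) (j≢k ∘ a-inj j k)
    (AdjMinusK G a b) outside (connected (b b₀)) eulerian
  where
  b₀ b₁ : Fin 2
  b₀ = zero
  b₁ = suc zero
  j : Fin 3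
  j = proj₁ (anotherIndex k)
  j≢k : j ≢ k
  j≢k = proj₂ (anotherIndex k)
  outside : ∀ p q → AdjMinusK G a b p q →
            Adj G p q × edgeCount (b b₀) (a j ∷ b b₁ ∷ a k ∷ b b₀ ∷ []) p q ≡ 0
  outside p q (pq , ¬K) =
    pq , cong₂ _+_ (off (¬K ∘ K j b₀ ∘ sameEdge-swap))
           (cong₂ _+_ (off (¬K ∘ K j b₁))
             (cong₂ _+_ (off (¬K ∘ K k b₁ ∘ sameEdge-swap)) (cong₂ _+_ (off (¬K ∘ K k b₀)) refl)))
    where
    K : ∀ i i′ → SameEdge (a i) (b i′) p q → KEdge a b p q
    K i i′ e = i , i′ , sameEdge-sym e
    off : ∀ {x y} → ¬ SameEdge x y p q → δ x y p q ≡ 0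
    off {x} {y} = indicator-no (sameEdge? x y p q)
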